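{- Let $A$ be a subset of $\Delta^{m-1}\times\Delta^{n-1}=\{(e_i,f_j):i\in[m],j\in[n]\}$, let $\mathcal T$ be a triangulation of $A$, and let $\mathcal T'$ be the result of a flip on $\mathcal T$ supported on a circuit $X=(X^+,X^-)$. Suppose that $\sigma\in\mathcal T$, $\sigma\notin\mathcal T'$, and $G(\sigma)$ is connected. Then $\sigma$ contains a maximal simplex of $\mathcal T_X^+$.
   Context: $e_1,\dots,e_m$ and $f_1,\dots,f_n$ are the standard bases of $\mathbb R^m$, $\mathbb R^n$. For a subset $C\subseteq\Delta^{m-1}\times\Delta^{n-1}$, $G(C)$ is the minimal subgraph of the complete bipartite graph on vertex set $\{e_1,\dots,e_m\}\cup\{f_1,\dots,f_n\}$ with edge set $\{e_if_j:(e_i,f_j)\in C\}$. A triangulation of $A$ is a collection of affinely independent subsets (simplices) of $A$, closed under faces, whose convex hulls cover $\mathrm{conv}(A)$ and intersect pairwise in convex hulls of common faces. A circuit is a minimal affinely dependent set $X$, split $X=X^+\sqcup X^-$ by the signs of its (unique up to scaling) affine dependence; $\mathcal T_X^{\pm}:=\{\sigma\subseteq X:\sigma\not\supseteq X^\pm\}$. The link of $C$ in $\mathcal T$ is $\{C'\in\mathcal T:C\cap C'=\emptyset,C\cup C'\in\mathcal T\}$. $\mathcal T$ has a flip supported on $(X^+,X^-)$ if $\mathcal T_X^+\subseteq\mathcal T$ and all maximal simplices of $\mathcal T_X^+$ have the same link $\mathcal L$ in $\mathcal T$; the result is $\mathcal T\setminus\{\rho\cup\tau:\rho\in\mathcal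 L,\tau\in\mathcal T_X^+\}\cup\{\rho\cup\tau:\rho\in\mathcal L,\tau\in\mathcal T_X^-\}$. -}

module Defs where

open import Data.Bool using (Bool; true; false; _∨_; _∧_; if_then_else_)
open import Data.Fin using (Fin; zero; suc; _≟_)
open import Data.Nat using (ℕ; zero; suc)
open import Data.Product using (Σ; ∃; _×_; _,_)
open import Data.Empty using (⊥)
open import Data.Sum using (_⊎_; inj₁; inj₂)
open import Data.Vec using (Vec; lookup; zipWith)
open import Data.Rational using (ℚ; 0ℚ; 1ℚ; _+_; _*_; _<_)
open import Relation.Binary.PropositionalEquality using (_≡_; _≢_)
open import Relation.Nullary using (¬_; does)
open import Relation.Binary.Construct.Closure.ReflexiveTransitive using (Star)

-- Points of Δ^{m-1} × Δ^{n-1}: the pair (e_i , f_j) is indexed by (i , j).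
-- A finite subset of these points ("cell") is a Boolean m×n table.

Cell : ℕ → ℕ → Set
Cell m n = Vec (Vec Bool n) m

module _ {m n : ℕ} where

  _∈c_ : Fin m × Fin n → Cell m n → Set
  (i , j) ∈c σ = lookup (lookup σ i) j ≡ true

  _⊆c_ : Cell m n → Cell m n → Set
  τ ⊆c σ = ∀ i j → (i , j) ∈c τ → (i , j) ∈c σ

  _∪c_ : Cell m n → Cell m n → Cell m n
  σ ∪c τ = zipWith (zipWith _∨_) σ τ

  _∩c_ : Cell m n → Cell m n → Cell m n
  σ ∩c τ = zipWith (zipWith _∧_) σ τ

  Disjoint : Cell m n → Cell m n → Set
  Disjoint σ τ = ∀ i j → (i , j) ∈c σ → ¬ ((i , j) ∈c τ)

sumFin : {k : ℕ} → (Fin k → ℚ) → ℚ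
sumFin {zero} f = 0ℚ
sumFin {suc k} f = f zero + sumFin (λ x → f (suc x))

sum2 : {m n : ℕ} → (Fin m → Fin n → ℚ) → ℚ
sum2 f = sumFin (λ i → sumFin (λ j → f i j))

point : {m n : ℕ} → Fin m → Fin n → (Fin m ⊎ Fin n) → ℚ
point i j (inj₁ i') = if does (i ≟ i') then 1ℚ else 0ℚ
point i j (inj₂ j') = if does (j ≟ j') then 1ℚ else 0ℚ

module _ {m n : ℕ} where

  Coeffs : Set
  Coeffs = Fin m → Fin n → ℚ

  SupportedOn : Coeffs → Cell m n → Set
  SupportedOn λ' σ = ∀ i j → ¬ ((i , j) ∈c σ) → λ' i j ≡ 0ℚ

  IsAffineRelation : Coeffs → Set
  IsAffineRelation λ' =
    (sum2 λ' ≡ 0ℚ) × (∀ k → sum2 (λ i j → λ' i j * point i j k) ≡ 0ℚ)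

  Nonzero : Coeffs → Set
  Nonzero λ' = ∃ λ i → ∃ λ j → λ' i j ≢ 0ℚ

  AffinelyIndependent : Cell m n → Set
  AffinelyIndependent σ =
    ∀ λ' → SupportedOn λ' σ → IsAffineRelation λ' → ∀ i j → λ' i j ≡ 0ℚ

  InConv : ((Fin m ⊎ Fin n) → ℚ) → Cell m n → Set
  InConv x σ = Σ Coeffs λ μ →
    SupportedOn μ σ × (∀ i j → ¬ (μ i j < 0ℚ)) × (sum2 μ ≡ 1ℚ) ×
    (∀ k → x k ≡ sum2 (λ i j → μ i j * point i j k))

  record IsTriangulation (A : Cell m n) (T : Cell m n → Set) : Set where
    field
      sub-A      : ∀ σ → T σ → σ ⊆c A
      affInd     : ∀ σ → T σ → AffinelyIndependent σ
      faces      : ∀ σ τ → T σ → τ ⊆c σ → T τ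
      covers     : ∀ x → InConv x A → ∃ λ σ → T σ × InConv x σ
      intersects : ∀ σ τ → T σ → T τ → ∀ x →
                   InConv x σ → InConv x τ → InConv x (σ ∩c τ)

  record IsCircuit (A Xp Xm : Cell m n) : Set where
    field
      in-A        : (Xp ∪c Xm) ⊆c A
      dependent   : ¬ AffinelyIndependent (Xp ∪c Xm)
      minimal     : ∀ Y → Y ⊆c (Xp ∪c Xm) → Y ≢ (Xp ∪c Xm) → AffinelyIndependent Y
      relation    : Coeffs
      rel-support : SupportedOn relation (Xp ∪c Xm)
      rel-affine  : IsAffineRelation relation
      rel-plus    : ∀ i j → ((i , j) ∈c Xp → 0ℚ < relation i j)
                              × (0ℚ < relation i j → (i , j) ∈c Xp)
      rel-minus   : ∀ i j → ((i , j) ∈c Xm → relation i j < 0ℚ)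
                              × (relation i j < 0ℚ → (i , j) ∈c Xm)

  -- 𝒯_X^± for the circuit with parts P (= X^±) and X = Xp ∪ Xm
  TX : (X P : Cell m n) → Cell m n → Set
  TX X P σ = (σ ⊆c X) × ¬ (P ⊆c σ)

  MaximalIn : (Cell m n → Set) → Cell m n → Set
  MaximalIn S τ = S τ × (∀ τ' → S τ' → τ ⊆c τ' → τ' ≡ τ)

  Link : (T : Cell m n → Set) → Cell m n → Cell m n → Set
  Link T C C' = T C' × Disjoint C C' × T (C ∪c C')

  record HasFlip (T : Cell m n → Set) (Xp Xm : Cell m n)
                 (L : Cell m n → Set) : Set where
    field
      plus-in    : ∀ σ → TX (Xp ∪c Xm) Xp σ → T σ
      common-link : ∀ τ → MaximalIn (TX (Xp ∪c Xm) Xp) τ →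
                    ∀ ρ → (Link T τ ρ → L ρ) × (L ρ → Link T τ ρ)

  FlipResult : (T : Cell m n → Set) (Xp Xm : Cell m n)
               (L : Cell m n → Set) → Cell m n → Set
  FlipResult T Xp Xm L σ =
    (T σ × ¬ (Σ (Cell m n) λ ρ → Σ (Cell m n) λ τ →
               L ρ × TX (Xp ∪c Xm) Xp τ × σ ≡ (ρ ∪c τ)))
    ⊎ (Σ (Cell m n) λ ρ → Σ (Cell m n) λ τ →
               L ρ × TX (Xp ∪c Xm) Xm τ × σ ≡ (ρ ∪c τ))

  Adj : Cell m n → (Fin m ⊎ Fin n) → (Fin m ⊎ Fin n) → Set
  Adj σ (inj₁ i) (inj₂ j) = (i , j) ∈c σ
  Adj σ (inj₂ j) (inj₁ i) = (i , j) ∈c σ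
  Adj σ _ _ = ⊥

  VertexOf : Cell m n → (Fin m ⊎ Fin n) → Set
  VertexOf σ u = ∃ λ v → Adj σ u v

  Connected : Cell m n → Set
  Connected σ = ∀ u v → VertexOf σ u → VertexOf σ v → Star (Adj σ) u v

-- Let σ ∈ 𝒯 be destroyed by the flip. Then σ = ρ ∪ τ with ρ in the common link and τ ⊆ X,
-- and since σ is not recreated as ρ ∪ (σ ∩ X) with σ ∩ X ∈ 𝒯_X^-, we get X⁻ ⊆ σ; as X is
-- dependent, some x ∈ X⁺ is missing from σ. We show X ∖ x ⊆ σ, which is a maximal simplex of
-- 𝒯_X^+. If y = (e_a , f_b) ∈ X ∖ x were missing from σ, then y ∈ X⁺; the circuit relation sums
-- to zero along row a and column b, so it has negative entries there, which lie in X⁻ ⊆ σ. Hence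
-- e_a and f_b are vertices of the connected graph G(σ), joined by a walk. Closing that walk with
-- the edge y gives a closed walk whose alternating sum of edges is an affine dependence supported
-- on σ ∪ {y} ⊆ (X ∖ x) ∪ ρ, a simplex of 𝒯, with coefficient 1 at y: a contradiction.
module Submission where

open import Defs
open import Data.Bool using (Bool; true; false; _∨_; _∧_; not; if_then_else_)
open import Data.Bool.Properties
  using (∨-zeroʳ; ∧-conicalˡ; ∧-conicalʳ; if-float; if-cong₂; if-∧)
  renaming (_≟_ to _≟ᵇ_)
open import Data.Fin using (Fin; zero; suc; _≟_)
open import Data.Fin.Properties using (any?; all?; ¬∀⟶∃¬)
open import Data.Nat using (ℕ)
open import Data.Product using (Σ; ∃; ∃₂; _×_; _,_; proj₁; proj₂; uncurry)
open import Data.Rational using (ℚ; 0ℚ; 1ℚ; _+_; _*_; _-_; _<_; _≤_; _<?_)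
open import Data.Rational.Properties
  using (+-identityˡ; +-identityʳ; +-inverseʳ; +-comm; *-identityˡ; *-identityʳ; *-zeroˡ; *-zeroʳ;
         +-mono-≤; +-monoˡ-≤; +-monoʳ-≤; ≤-refl; ≮⇒≥; <-≤-trans; <-irrefl; module ≤-Reasoning)
open import Data.Rational.Solver using (module +-*-Solver)
open import Data.Sum using (_⊎_; inj₁; inj₂)
open import Data.Vec using (Vec; lookup; zipWith; tabulate)
open import Data.Vec.Properties using (lookup-zipWith; lookup∘tabulate; tabulate∘lookup; tabulate-cong)
open import Function using (_∘_)
open import Relation.Binary.Construct.Closure.ReflexiveTransitive using (Star; ε; _◅_)
open import Relation.Binary.PropositionalEquality
open import Relation.Nullary using (¬_; Dec; yes; no; does; contradiction)
open import Relation.Nullary.Decidable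
  using (decidable-stable; dec-true; dec-false; map′; _×-dec_; _→-dec_)

open +-*-Solver using (solve; _:+_; _:-_; _:*_; _:=_)

module _ {m n : ℕ} where

  entry : Cell m n → Fin m → Fin n → Bool
  entry σ i j = lookup (lookup σ i) j

  _∈c?_ : ∀ (p : Fin m × Fin n) σ → Dec (p ∈c σ)
  (i , j) ∈c? σ = entry σ i j ≟ᵇ true

  _≟ₚ_ : ∀ (p q : Fin m × Fin n) → Dec (p ≡ q)
  (i , j) ≟ₚ (a , b) =
    map′ (uncurry (cong₂ _,_)) (λ eq → cong proj₁ eq , cong proj₂ eq) ((i ≟ a) ×-dec (j ≟ b))

  entry-∪ : ∀ σ τ i j → entry (σ ∪c τ) i j ≡ entry σ i j ∨ entry τ i j
  entry-∪ σ τ i j = trans (cong (λ row → lookup row j) (lookup-zipWith (zipWith _∨_) i σ τ))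
                          (lookup-zipWith _∨_ j (lookup σ i) (lookup τ i))

  entry-∩ : ∀ σ τ i j → entry (σ ∩c τ) i j ≡ entry σ i j ∧ entry τ i j
  entry-∩ σ τ i j = trans (cong (λ row → lookup row j) (lookup-zipWith (zipWith _∧_) i σ τ))
                          (lookup-zipWith _∧_ j (lookup σ i) (lookup τ i))

  ∈-∪⁻ : ∀ σ τ i j → (i , j) ∈c (σ ∪c τ) → (i , j) ∈c σ ⊎ (i , j) ∈c τ
  ∈-∪⁻ σ τ i j ∈σ∪τ = ∨-true⁻ (entry σ i j) (trans (sym (entry-∪ σ τ i j)) ∈σ∪τ)
    where
    ∨-true⁻ : ∀ x {y} → x ∨ y ≡ true → x ≡ true ⊎ y ≡ true
    ∨-true⁻ true  _   = inj₁ refl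
    ∨-true⁻ false y≡t = inj₂ y≡t

  ∈-∪⁺ˡ : ∀ σ τ i j → (i , j) ∈c σ → (i , j) ∈c (σ ∪c τ)
  ∈-∪⁺ˡ σ τ i j ∈σ = trans (entry-∪ σ τ i j) (cong (_∨ entry τ i j) ∈σ)

  ∈-∪⁺ʳ : ∀ σ τ i j → (i , j) ∈c τ → (i , j) ∈c (σ ∪c τ)
  ∈-∪⁺ʳ σ τ i j ∈τ = trans (entry-∪ σ τ i j) (trans (cong (entry σ i j ∨_) ∈τ) (∨-zeroʳ _))

  ∈-∩⁻ˡ : ∀ σ τ i j → (i , j) ∈c (σ ∩c τ) → (i , j) ∈c σ
  ∈-∩⁻ˡ σ τ i j ∈σ∩τ = ∧-conicalˡ _ _ (trans (sym (entry-∩ σ τ i j)) ∈σ∩τ)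

  ∈-∩⁻ʳ : ∀ σ τ i j → (i , j) ∈c (σ ∩c τ) → (i , j) ∈c τ
  ∈-∩⁻ʳ σ τ i j ∈σ∩τ = ∧-conicalʳ _ _ (trans (sym (entry-∩ σ τ i j)) ∈σ∩τ)

  ∈-∩⁺ : ∀ σ τ i j → (i , j) ∈c σ → (i , j) ∈c τ → (i , j) ∈c (σ ∩c τ)
  ∈-∩⁺ σ τ i j ∈σ ∈τ = trans (entry-∩ σ τ i j) (cong₂ _∧_ ∈σ ∈τ)

  ⊆-antisym : ∀ {σ τ : Cell m n} → σ ⊆c τ → τ ⊆c σ → σ ≡ τ
  ⊆-antisym σ⊆τ τ⊆σ = lookup-ext (λ i → lookup-ext (λ j → entry-ext (σ⊆τ i j) (τ⊆σ i j)))
    where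
    lookup-ext : ∀ {A : Set} {k} {u v : Vec A k} → (∀ i → lookup u i ≡ lookup v i) → u ≡ v
    lookup-ext {u = u} {v} u≗v =
      trans (sym (tabulate∘lookup u)) (trans (tabulate-cong u≗v) (tabulate∘lookup v))
    entry-ext : ∀ {x y : Bool} → (x ≡ true → y ≡ true) → (y ≡ true → x ≡ true) → x ≡ y
    entry-ext {true}  {_}     x⇒y _   = sym (x⇒y refl)
    entry-ext {false} {true}  _   y⇒x = y⇒x refl
    entry-ext {false} {false} _   _   = refl

  ∪-lub : ∀ (ρ τ σ : Cell m n) → ρ ⊆c σ → τ ⊆c σ → (ρ ∪c τ) ⊆c σ
  ∪-lub ρ τ σ ρ⊆σ τ⊆σ i j ∈ρ∪τ with ∈-∪⁻ ρ τ i j ∈ρ∪τ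
  ... | inj₁ ∈ρ = ρ⊆σ i j ∈ρ
  ... | inj₂ ∈τ = τ⊆σ i j ∈τ

  _⊆c?_ : ∀ τ σ → Dec (τ ⊆c σ)
  τ ⊆c? σ = all? (λ i → all? (λ j → ((i , j) ∈c? τ) →-dec ((i , j) ∈c? σ)))

  ⊈-witness : ∀ τ σ → ¬ (τ ⊆c σ) → ∃ λ i → ∃ λ j → (i , j) ∈c τ × ¬ ((i , j) ∈c σ)
  ⊈-witness τ σ τ⊈σ with ¬∀⟶∃¬ m _ (λ i → all? (λ j → ((i , j) ∈c? τ) →-dec ((i , j) ∈c? σ))) τ⊈σ
  ... | i , row⊈ with ¬∀⟶∃¬ n _ (λ j → ((i , j) ∈c? τ) →-dec ((i , j) ∈c? σ)) row⊈
  ... | j , ¬τ⇒σ = i , j , decidable-stable ((i , j) ∈c? τ) (λ ∉τ → ¬τ⇒σ (λ ∈τ → contradiction ∈τ ∉τ))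
                         , (λ ∈σ → ¬τ⇒σ (λ _ → ∈σ))

  infix 25 _∖_
  _∖_ : Cell m n → Fin m × Fin n → Cell m n
  X ∖ p = tabulate (λ i → tabulate (λ j → entry X i j ∧ not (does ((i , j) ≟ₚ p))))

  entry-∖ : ∀ X p i j → entry (X ∖ p) i j ≡ entry X i j ∧ not (does ((i , j) ≟ₚ p))
  entry-∖ X p i j = trans (cong (λ row → lookup row j) (lookup∘tabulate _ i)) (lookup∘tabulate _ j)

  ∈-∖⁺ : ∀ X p i j → (i , j) ∈c X → (i , j) ≢ p → (i , j) ∈c (X ∖ p)
  ∈-∖⁺ X p i j ∈X ≢p = trans (entry-∖ X p i j) (cong₂ _∧_ ∈X (cong not (dec-false ((i , j) ≟ₚ p) ≢p)))

  ∈-∖⁻ : ∀ X p i j → (i , j) ∈c (X ∖ p) → (i , j) ∈c X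
  ∈-∖⁻ X p i j ∈X∖p = ∧-conicalˡ _ _ (trans (sym (entry-∖ X p i j)) ∈X∖p)

  ∉-∖ : ∀ X p i j → (i , j) ∈c (X ∖ p) → (i , j) ≢ p
  ∉-∖ X p i j ∈X∖p ≡p =
    contradiction (subst (λ b → not b ≡ true) (dec-true ((i , j) ≟ₚ p) ≡p)
                         (∧-conicalʳ _ _ (trans (sym (entry-∖ X p i j)) ∈X∖p)))
                  λ ()

  ∖-maximal : ∀ (X P : Cell m n) {a b} → P ⊆c X → (a , b) ∈c P → MaximalIn (TX X P) (X ∖ (a , b))
  ∖-maximal X P {a} {b} P⊆X ab∈P =
    (∈-∖⁻ X (a , b) , λ P⊆X∖ab → ∉-∖ X (a , b) a b (P⊆X∖ab a b ab∈P) refl) ,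
    λ τ (τ⊆X , P⊈τ) X∖ab⊆τ → ⊆-antisym (τ⊆X∖ab τ τ⊆X P⊈τ X∖ab⊆τ) X∖ab⊆τ
    where
    P⊆ : ∀ τ → X ∖ (a , b) ⊆c τ → (a , b) ∈c τ → P ⊆c τ
    P⊆ τ X∖ab⊆τ ab∈τ i j ∈P with (i , j) ≟ₚ (a , b)
    ... | yes refl = ab∈τ
    ... | no  ≢ab  = X∖ab⊆τ i j (∈-∖⁺ X (a , b) i j (P⊆X i j ∈P) ≢ab)
    τ⊆X∖ab : ∀ τ → τ ⊆c X → ¬ (P ⊆c τ) → X ∖ (a , b) ⊆c τ → τ ⊆c X ∖ (a , b)
    τ⊆X∖ab τ τ⊆X P⊈τ X∖ab⊆τ i j ∈τ =
      ∈-∖⁺ X (a , b) i j (τ⊆X i j ∈τ) λ { refl → P⊈τ (P⊆ τ X∖ab⊆τ ∈τ) }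

  ∪-restrict : ∀ {σ ρ τ} (X : Cell m n) → σ ≡ ρ ∪c τ → τ ⊆c X → σ ≡ ρ ∪c (σ ∩c X)
  ∪-restrict {ρ = ρ} {τ} X refl τ⊆X =
    ⊆-antisym (∪-lub ρ τ (ρ ∪c σ∩X) (∈-∪⁺ˡ ρ σ∩X) λ i j ∈τ →
                 ∈-∪⁺ʳ ρ σ∩X i j (∈-∩⁺ (ρ ∪c τ) X i j (∈-∪⁺ʳ ρ τ i j ∈τ) (τ⊆X i j ∈τ)))
              (∪-lub ρ σ∩X (ρ ∪c τ) (∈-∪⁺ˡ ρ τ) (∈-∩⁻ˡ (ρ ∪c τ) X))
    where
    σ∩X : Cell m n
    σ∩X = (ρ ∪c τ) ∩c X

  ⊆-∖∪ : ∀ {σ ρ τ} (X : Cell m n) {a b} → σ ≡ ρ ∪c τ → τ ⊆c X → ¬ ((a , b) ∈c σ) →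
         σ ⊆c ((X ∖ (a , b)) ∪c ρ)
  ⊆-∖∪ {ρ = ρ} {τ} X {a} {b} refl τ⊆X ab∉σ =
    ∪-lub ρ τ ((X ∖ (a , b)) ∪c ρ) (∈-∪⁺ʳ (X ∖ (a , b)) ρ) λ i j ∈τ →
      ∈-∪⁺ˡ (X ∖ (a , b)) ρ i j (∈-∖⁺ X (a , b) i j (τ⊆X i j ∈τ) λ { refl → ab∉σ (∈-∪⁺ʳ ρ τ i j ∈τ) })

-- Finite sums over ℚ

sumFin-cong : ∀ {k} {f g : Fin k → ℚ} → (∀ x → f x ≡ g x) → sumFin f ≡ sumFin g
sumFin-cong {ℕ.zero}  f≗g = refl
sumFin-cong {ℕ.suc k} f≗g = cong₂ _+_ (f≗g zero) (sumFin-cong (f≗g ∘ suc))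

sumFin-zero : ∀ {k} → sumFin {k} (λ _ → 0ℚ) ≡ 0ℚ
sumFin-zero {ℕ.zero}  = refl
sumFin-zero {ℕ.suc k} = trans (cong (0ℚ +_) (sumFin-zero {k})) (+-identityʳ 0ℚ)

sumFin-sub : ∀ {k} (f g : Fin k → ℚ) → sumFin (λ x → f x - g x) ≡ sumFin f - sumFin g
sumFin-sub {ℕ.zero}  f g = sym (+-inverseʳ 0ℚ)
sumFin-sub {ℕ.suc k} f g = begin
  (f zero - g zero) + sumFin (λ x → f (suc x) - g (suc x))
    ≡⟨ cong ((f zero - g zero) +_) (sumFin-sub (f ∘ suc) (g ∘ suc)) ⟩
  (f zero - g zero) + (sumFin (f ∘ suc) - sumFin (g ∘ suc))
    ≡⟨ interchange (f zero) (g zero) _ _ ⟩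
  (f zero + sumFin (f ∘ suc)) - (g zero + sumFin (g ∘ suc)) ∎
  where
  open ≡-Reasoning
  interchange : ∀ a b c d → (a - b) + (c - d) ≡ (a + c) - (b + d)
  interchange = solve 4 (λ a b c d → (a :- b) :+ (c :- d) := (a :+ c) :- (b :+ d)) refl

sumFin-if : ∀ {k} b (f : Fin k → ℚ) → sumFin (λ x → if b then f x else 0ℚ) ≡ (if b then sumFin f else 0ℚ)
sumFin-if     true  f = refl
sumFin-if {k} false f = sumFin-zero {k}

sumFin-pick : ∀ {k} (a : Fin k) (f : Fin k → ℚ) → sumFin (λ x → if does (x ≟ a) then f x else 0ℚ) ≡ f a
sumFin-pick {ℕ.suc k} zero    f = trans (cong (f zero +_) (sumFin-zero {k})) (+-identityʳ (f zero))
sumFin-pick {ℕ.suc k} (suc a) f = trans (+-identityˡ _) (sumFin-pick a (f ∘ suc))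

sumFin-nonneg : ∀ {k} {f : Fin k → ℚ} → (∀ x → 0ℚ ≤ f x) → 0ℚ ≤ sumFin f
sumFin-nonneg {ℕ.zero}  f≥0 = ≤-refl
sumFin-nonneg {ℕ.suc k} f≥0 = +-mono-≤ (f≥0 zero) (sumFin-nonneg (f≥0 ∘ suc))

≤-sumFin : ∀ {k} {f : Fin k → ℚ} → (∀ x → 0ℚ ≤ f x) → ∀ a → f a ≤ sumFin f
≤-sumFin {f = f} f≥0 zero = begin
  f zero                    ≡⟨ sym (+-identityʳ (f zero)) ⟩
  f zero + 0ℚ               ≤⟨ +-monoʳ-≤ (f zero) (sumFin-nonneg (f≥0 ∘ suc)) ⟩
  f zero + sumFin (f ∘ suc) ∎
  where open ≤-Reasoning
≤-sumFin {f = f} f≥0 (suc a) = begin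
  f (suc a)                 ≤⟨ ≤-sumFin (f≥0 ∘ suc) a ⟩
  sumFin (f ∘ suc)          ≡⟨ sym (+-identityˡ _) ⟩
  0ℚ + sumFin (f ∘ suc)     ≤⟨ +-monoˡ-≤ (sumFin (f ∘ suc)) (f≥0 zero) ⟩
  f zero + sumFin (f ∘ suc) ∎
  where open ≤-Reasoning

sumFin≡0⇒negative : ∀ {k} {f : Fin k → ℚ} {a} → sumFin f ≡ 0ℚ → 0ℚ < f a → ∃ λ x → f x < 0ℚ
sumFin≡0⇒negative {f = f} {a} Σf≡0 fa>0 with any? (λ x → f x <? 0ℚ)
... | yes negative = negative
... | no  none     =
  contradiction (<-≤-trans fa>0 (subst (f a ≤_) Σf≡0 (≤-sumFin f≥0 a))) (<-irrefl refl)
  where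
  f≥0 : ∀ x → 0ℚ ≤ f x
  f≥0 x = ≮⇒≥ (λ fx<0 → none (x , fx<0))

module _ {m n : ℕ} where

  sum2-cong : {f g : Fin m → Fin n → ℚ} → (∀ i j → f i j ≡ g i j) → sum2 f ≡ sum2 g
  sum2-cong f≗g = sumFin-cong (λ i → sumFin-cong (f≗g i))

  sum2-zero : sum2 {m} {n} (λ _ _ → 0ℚ) ≡ 0ℚ
  sum2-zero = trans (sumFin-cong {m} (λ _ → sumFin-zero {n})) (sumFin-zero {m})

  sum2-sub : (f g : Fin m → Fin n → ℚ) → sum2 (λ i j → f i j - g i j) ≡ sum2 f - sum2 g
  sum2-sub f g = trans (sumFin-cong (λ i → sumFin-sub (f i) (g i)))
                       (sumFin-sub (λ i → sumFin (f i)) (λ i → sumFin (g i)))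

  sum2-pick : ∀ a b (w : Fin m → Fin n → ℚ) →
              sum2 (λ i j → if does ((i , j) ≟ₚ (a , b)) then w i j else 0ℚ) ≡ w a b
  sum2-pick a b w = begin
    sum2 (λ i j → if does (i ≟ a) ∧ does (j ≟ b) then w i j else 0ℚ)
      ≡⟨ sum2-cong (λ i j → if-∧ (does (i ≟ a))) ⟩
    sumFin (λ i → sumFin (λ j → if does (i ≟ a) then (if does (j ≟ b) then w i j else 0ℚ) else 0ℚ))
      ≡⟨ sumFin-cong (λ i → sumFin-if (does (i ≟ a)) (λ j → if does (j ≟ b) then w i j else 0ℚ)) ⟩
    sumFin (λ i → if does (i ≟ a) then sumFin (λ j → if does (j ≟ b) then w i j else 0ℚ) else 0ℚ)
      ≡⟨ sumFin-pick a _ ⟩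
    sumFin (λ j → if does (j ≟ b) then w a j else 0ℚ)
      ≡⟨ sumFin-pick b (w a) ⟩
    w a b ∎
    where open ≡-Reasoning

-- Affine combinations of the points (e_i , f_j)

*-indicator : ∀ x b → x * (if b then 1ℚ else 0ℚ) ≡ (if b then x else 0ℚ)
*-indicator x b = trans (if-float (x *_) b) (if-cong₂ b (*-identityʳ x) (*-zeroʳ x))

indicator-* : ∀ b x → (if b then 1ℚ else 0ℚ) * x ≡ (if b then x else 0ℚ)
indicator-* b x = trans (if-float (_* x) b) (if-cong₂ b (*-identityˡ x) (*-zeroˡ x))

module _ {m n : ℕ} where

  combination : Coeffs {m} {n} → (Fin m ⊎ Fin n) → ℚ
  combination c k = sum2 (λ i j → c i j * point i j k)

  _-ᶜ_ : Coeffs {m} {n} → Coeffs → Coeffs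
  (c -ᶜ d) i j = c i j - d i j

  unitCoeffs : Fin m → Fin n → Coeffs
  unitCoeffs a b i j = if does ((i , j) ≟ₚ (a , b)) then 1ℚ else 0ℚ

  unitCoeffs-diag : ∀ a b → unitCoeffs a b a b ≡ 1ℚ
  unitCoeffs-diag a b = cong (if_then 1ℚ else 0ℚ) (dec-true ((a , b) ≟ₚ (a , b)) refl)

  sum2-unit : ∀ a b → sum2 (unitCoeffs a b) ≡ 1ℚ
  sum2-unit a b = sum2-pick a b (λ _ _ → 1ℚ)

  combination-unit : ∀ a b k → combination (unitCoeffs a b) k ≡ point a b k
  combination-unit a b k =
    trans (sum2-cong (λ i j → indicator-* (does ((i , j) ≟ₚ (a , b))) (point i j k)))
          (sum2-pick a b (λ i j → point i j k))

  combination-sub : ∀ c d k → combination (c -ᶜ d) k ≡ combination c k - combination d k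
  combination-sub c d k =
    trans (sum2-cong (λ i j → *-distribʳ-sub (c i j) (d i j) (point i j k)))
          (sum2-sub (λ i j → c i j * point i j k) (λ i j → d i j * point i j k))
    where
    *-distribʳ-sub : ∀ x y z → (x - y) * z ≡ x * z - y * z
    *-distribʳ-sub = solve 3 (λ x y z → (x :- y) :* z := x :* z :- y :* z) refl

  combination-row : ∀ c a → combination c (inj₁ a) ≡ sumFin (c a)
  combination-row c a = begin
    sumFin (λ i → sumFin (λ j → c i j * (if does (i ≟ a) then 1ℚ else 0ℚ)))
      ≡⟨ sum2-cong (λ i j → *-indicator (c i j) (does (i ≟ a))) ⟩
    sumFin (λ i → sumFin (λ j → if does (i ≟ a) then c i j else 0ℚ))
      ≡⟨ sumFin-cong (λ i → sumFin-if (does (i ≟ a)) (c i)) ⟩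
    sumFin (λ i → if does (i ≟ a) then sumFin (c i) else 0ℚ)
      ≡⟨ sumFin-pick a (λ i → sumFin (c i)) ⟩
    sumFin (c a) ∎
    where open ≡-Reasoning

  combination-column : ∀ c b → combination c (inj₂ b) ≡ sumFin (λ i → c i b)
  combination-column c b =
    sumFin-cong (λ i → trans (sumFin-cong (λ j → *-indicator (c i j) (does (j ≟ b))))
                             (sumFin-pick b (c i)))

  supportedOn-sub : ∀ {c d} (σ : Cell m n) → SupportedOn c σ → SupportedOn d σ → SupportedOn (c -ᶜ d) σ
  supportedOn-sub σ c↾σ d↾σ i j ∉σ = trans (cong₂ _-_ (c↾σ i j ∉σ) (d↾σ i j ∉σ)) (+-inverseʳ 0ℚ)

  supportedOn-unit : ∀ (σ : Cell m n) {a b} → (a , b) ∈c σ → SupportedOn (unitCoeffs a b) σ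
  supportedOn-unit σ {a} {b} ab∈σ i j ∉σ =
    cong (if_then 1ℚ else 0ℚ) (dec-false ((i , j) ≟ₚ (a , b)) (λ { refl → ∉σ ab∈σ }))

  supportedOn-⊆ : ∀ {c} (σ τ : Cell m n) → SupportedOn c σ → σ ⊆c τ → SupportedOn c τ
  supportedOn-⊆ σ τ c↾σ σ⊆τ i j ∉τ = c↾σ i j (λ ∈σ → ∉τ (σ⊆τ i j ∈σ))

  affinelyIndependent-⊆ : ∀ (σ τ : Cell m n) → AffinelyIndependent σ → τ ⊆c σ → AffinelyIndependent τ
  affinelyIndependent-⊆ σ τ σ-indep τ⊆σ c c↾τ = σ-indep c (supportedOn-⊆ τ σ c↾τ τ⊆σ)

  affineRelation-row⁻ : ∀ {c a b} → IsAffineRelation c → 0ℚ < c a b → ∃ λ j → c a j < 0ℚ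
  affineRelation-row⁻ {c} {a} (_ , c-affine) =
    sumFin≡0⇒negative (trans (sym (combination-row c a)) (c-affine (inj₁ a)))

  affineRelation-column⁻ : ∀ {c a b} → IsAffineRelation c → 0ℚ < c a b → ∃ λ i → c i b < 0ℚ
  affineRelation-column⁻ {c} {b = b} (_ , c-affine) =
    sumFin≡0⇒negative (trans (sym (combination-column c b)) (c-affine (inj₂ b)))

  ¬circuit⊆independent : ∀ {A Xp Xm : Cell m n} σ → IsCircuit A Xp Xm → AffinelyIndependent σ →
                         ¬ ((Xp ∪c Xm) ⊆c σ)
  ¬circuit⊆independent {Xp = Xp} {Xm} σ circuit σ-indep X⊆σ =
    IsCircuit.dependent circuit (affinelyIndependent-⊆ σ (Xp ∪c Xm) σ-indep X⊆σ)

  circuit⁺-vertices : ∀ {A Xp Xm : Cell m n} σ → IsCircuit A Xp Xm → Xm ⊆c σ → ∀ {a b} →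
                      (a , b) ∈c Xp → VertexOf σ (inj₁ a) × VertexOf σ (inj₂ b)
  circuit⁺-vertices σ circuit Xm⊆σ {a} {b} ab∈Xp =
    let j , aj<0 = affineRelation-row⁻ rel-affine ab>0
        i , ib<0 = affineRelation-column⁻ rel-affine ab>0
    in (inj₂ j , negative⇒∈σ a j aj<0) , (inj₁ i , negative⇒∈σ i b ib<0)
    where
    open IsCircuit circuit
    ab>0 : 0ℚ < relation a b
    ab>0 = proj₁ (rel-plus a b) ab∈Xp
    negative⇒∈σ : ∀ i j → relation i j < 0ℚ → (i , j) ∈c σ
    negative⇒∈σ i j ij<0 = Xm⊆σ i j (proj₂ (rel-minus i j) ij<0)

-- Walks in G(σ)

module _ {m n : ℕ} where

  basis : (Fin m ⊎ Fin n) → (Fin m ⊎ Fin n) → ℚ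
  basis (inj₁ i) (inj₁ i') = if does (i ≟ i') then 1ℚ else 0ℚ
  basis (inj₂ j) (inj₂ j') = if does (j ≟ j') then 1ℚ else 0ℚ
  basis (inj₁ _) (inj₂ _)  = 0ℚ
  basis (inj₂ _) (inj₁ _)  = 0ℚ

  point-basis : ∀ i j k → point i j k ≡ basis (inj₁ i) k + basis (inj₂ j) k
  point-basis i j (inj₁ _) = sym (+-identityʳ _)
  point-basis i j (inj₂ _) = sym (+-identityˡ _)

  point-basis′ : ∀ i j k → point i j k ≡ basis (inj₂ j) k + basis (inj₁ i) k
  point-basis′ i j k = trans (point-basis i j k) (+-comm (basis (inj₁ i) k) (basis (inj₂ j) k))

  -- The alternating sum of the edges of a walk from u to v has total weight walkWeight u v and
  -- sums to walkVector u v; for a closed walk both vanish.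
  walkWeight : (u v : Fin m ⊎ Fin n) → ℚ
  walkWeight (inj₁ _) (inj₁ _) = 0ℚ
  walkWeight (inj₂ _) (inj₂ _) = 0ℚ
  walkWeight (inj₁ _) (inj₂ _) = 1ℚ
  walkWeight (inj₂ _) (inj₁ _) = 1ℚ

  walkVector : (u v : Fin m ⊎ Fin n) → (Fin m ⊎ Fin n) → ℚ
  walkVector u@(inj₁ _) v@(inj₁ _) k = basis u k - basis v k
  walkVector u@(inj₂ _) v@(inj₂ _) k = basis u k - basis v k
  walkVector u@(inj₁ _) v@(inj₂ _) k = basis u k + basis v k
  walkVector u@(inj₂ _) v@(inj₁ _) k = basis u k + basis v k

  walkWeight-diag : ∀ v → walkWeight v v ≡ 0ℚ
  walkWeight-diag (inj₁ _) = refl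
  walkWeight-diag (inj₂ _) = refl

  walkVector-diag : ∀ v k → walkVector v v k ≡ 0ℚ
  walkVector-diag v@(inj₁ _) k = +-inverseʳ (basis v k)
  walkVector-diag v@(inj₂ _) k = +-inverseʳ (basis v k)

  data Opposite : (u w : Fin m ⊎ Fin n) → Set where
    e→f : ∀ {i j} → Opposite (inj₁ i) (inj₂ j)
    f→e : ∀ {i j} → Opposite (inj₂ j) (inj₁ i)

  walkWeight-step : ∀ {u w} → Opposite u w → ∀ v → 1ℚ - walkWeight w v ≡ walkWeight u v
  walkWeight-step e→f (inj₁ _) = +-inverseʳ 1ℚ
  walkWeight-step e→f (inj₂ _) = refl
  walkWeight-step f→e (inj₁ _) = refl
  walkWeight-step f→e (inj₂ _) = +-inverseʳ 1ℚ

  cancel-+ : ∀ x y z → (x + y) - (y + z) ≡ x - z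
  cancel-+ = solve 3 (λ x y z → (x :+ y) :- (y :+ z) := x :- z) refl

  cancel-- : ∀ x y z → (x + y) - (y - z) ≡ x + z
  cancel-- = solve 3 (λ x y z → (x :+ y) :- (y :- z) := x :+ z) refl

  walkVector-step : ∀ {u w} → Opposite u w → ∀ v k →
                    (basis u k + basis w k) - walkVector w v k ≡ walkVector u v k
  walkVector-step (e→f {i} {j}) v@(inj₁ _) k = cancel-+ (basis (inj₁ i) k) (basis (inj₂ j) k) (basis v k)
  walkVector-step (e→f {i} {j}) v@(inj₂ _) k = cancel-- (basis (inj₁ i) k) (basis (inj₂ j) k) (basis v k)
  walkVector-step (f→e {i} {j}) v@(inj₁ _) k = cancel-- (basis (inj₂ j) k) (basis (inj₁ i) k) (basis v k)
  walkVector-step (f→e {i} {j}) v@(inj₂ _) k = cancel-+ (basis (inj₂ j) k) (basis (inj₁ i) k) (basis v k)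

  WalkCombination : Cell m n → (u v : Fin m ⊎ Fin n) → Set
  WalkCombination σ u v = Σ Coeffs λ c →
    SupportedOn c σ × sum2 c ≡ walkWeight u v × (∀ k → combination c k ≡ walkVector u v k)

  walkCombination-⊆ : ∀ (σ S : Cell m n) {u v} → σ ⊆c S → WalkCombination σ u v → WalkCombination S u v
  walkCombination-⊆ σ S σ⊆S (c , c↾σ , sums) = c , supportedOn-⊆ σ S c↾σ σ⊆S , sums

  walkCombination-ε : ∀ σ v → WalkCombination σ v v
  walkCombination-ε σ v =
    (λ _ _ → 0ℚ) , (λ _ _ _ → refl) , trans (sum2-zero {m} {n}) (sym (walkWeight-diag v)) ,
    λ k → trans (sum2-cong (λ i j → *-zeroˡ (point i j k)))
                (trans (sum2-zero {m} {n}) (sym (walkVector-diag v k)))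

  walkCombination-◅ : ∀ σ {u w} v {a b} → Opposite u w → (a , b) ∈c σ →
                      (∀ k → point a b k ≡ basis u k + basis w k) →
                      WalkCombination σ w v → WalkCombination σ u v
  walkCombination-◅ σ {u} {w} v {a} {b} uw ab∈σ ab≡u+w (c , c↾σ , c-weight , c-vector) =
    unitCoeffs a b -ᶜ c , supportedOn-sub σ (supportedOn-unit σ ab∈σ) c↾σ , weight , vector
    where
    weight : sum2 (unitCoeffs a b -ᶜ c) ≡ walkWeight u v
    weight = begin
      sum2 (unitCoeffs a b -ᶜ c)        ≡⟨ sum2-sub (unitCoeffs a b) c ⟩
      sum2 (unitCoeffs a b) - sum2 c    ≡⟨ cong₂ _-_ (sum2-unit a b) c-weight ⟩
      1ℚ - walkWeight w v               ≡⟨ walkWeight-step uw v ⟩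
      walkWeight u v                    ∎
      where open ≡-Reasoning
    vector : ∀ k → combination (unitCoeffs a b -ᶜ c) k ≡ walkVector u v k
    vector k = begin
      combination (unitCoeffs a b -ᶜ c) k                ≡⟨ combination-sub (unitCoeffs a b) c k ⟩
      combination (unitCoeffs a b) k - combination c k  ≡⟨ cong₂ _-_ (combination-unit a b k) (c-vector k) ⟩
      point a b k - walkVector w v k                    ≡⟨ cong (_- walkVector w v k) (ab≡u+w k) ⟩
      (basis u k + basis w k) - walkVector w v k        ≡⟨ walkVector-step uw v k ⟩
      walkVector u v k                                  ∎
      where open ≡-Reasoning

  closedWalk-affine : ∀ σ v (w : WalkCombination σ v v) → IsAffineRelation (proj₁ w)
  closedWalk-affine σ v (c , _ , weight , vector) =
    trans weight (walkWeight-diag v) , λ k → trans (vector k) (walkVector-diag v k)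

  walkCombination : ∀ {σ u v} → Star (Adj σ) u v → WalkCombination σ u v
  walkCombination {σ} {v = v} ε = walkCombination-ε σ v
  walkCombination {σ} {v = v} (_◅_ {inj₁ a} {inj₂ b} ab∈σ walk) =
    walkCombination-◅ σ v e→f ab∈σ (point-basis a b) (walkCombination walk)
  walkCombination {σ} {v = v} (_◅_ {inj₂ b} {inj₁ a} ab∈σ walk) =
    walkCombination-◅ σ v f→e ab∈σ (point-basis′ a b) (walkCombination walk)

  walk⇒edge : ∀ {σ} S {a b} → AffinelyIndependent S → σ ⊆c S → (a , b) ∈c S →
              Star (Adj σ) (inj₁ a) (inj₂ b) → (a , b) ∈c σ
  walk⇒edge {σ} S {a} {b} S-indep σ⊆S ab∈S walk = decidable-stable ((a , b) ∈c? σ) λ ab∉σ →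
    contradiction (trans (sym (closed-at-ab ab∉σ)) (closed-vanishes a b)) λ ()
    where
    walk-σ : WalkCombination σ (inj₁ a) (inj₂ b)
    walk-σ = walkCombination walk
    closed : WalkCombination S (inj₂ b) (inj₂ b)
    closed = walkCombination-◅ S (inj₂ b) (f→e {i = a} {b}) ab∈S (point-basis′ a b)
                               (walkCombination-⊆ σ S {inj₁ a} {inj₂ b} σ⊆S walk-σ)
    closed-vanishes : ∀ i j → proj₁ closed i j ≡ 0ℚ
    closed-vanishes = S-indep (proj₁ closed) (proj₁ (proj₂ closed)) (closedWalk-affine S (inj₂ b) closed)
    closed-at-ab : ¬ ((a , b) ∈c σ) → proj₁ closed a b ≡ 1ℚ
    closed-at-ab ab∉σ = cong₂ _-_ (unitCoeffs-diag a b) (proj₁ (proj₂ walk-σ) a b ab∉σ)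

-- Flips

module Flip {m n : ℕ} (T : Cell m n → Set) (Xp Xm : Cell m n) (L : Cell m n → Set) where

  -- L is an arbitrary predicate, so σ ∉ 𝒯' only yields the decomposition σ = ρ ∪ τ under ¬¬.
  ∉flip⇒¬¬decomposed : ∀ {σ} → T σ → ¬ FlipResult T Xp Xm L σ →
                       ¬ ¬ (∃₂ λ ρ τ → L ρ × τ ⊆c (Xp ∪c Xm) × σ ≡ ρ ∪c τ)
  ∉flip⇒¬¬decomposed σ∈T σ∉T' ¬decomposed =
    σ∉T' (inj₁ (σ∈T , λ (ρ , τ , ρ∈L , (τ⊆X , _) , σ≡ρ∪τ) → ¬decomposed (ρ , τ , ρ∈L , τ⊆X , σ≡ρ∪τ)))

  ∉flip⇒X⁻⊆ : ∀ {σ} → T σ → ¬ FlipResult T Xp Xm L σ → Xm ⊆c σ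
  ∉flip⇒X⁻⊆ {σ} σ∈T σ∉T' = decidable-stable (Xm ⊆c? σ) λ Xm⊈σ →
    ∉flip⇒¬¬decomposed σ∈T σ∉T' λ (ρ , τ , ρ∈L , τ⊆X , σ≡ρ∪τ) →
      σ∉T' (inj₂ (ρ , σ ∩c X , ρ∈L ,
                  (∈-∩⁻ʳ σ X , λ Xm⊆σ∩X → Xm⊈σ λ i j ∈Xm → ∈-∩⁻ˡ σ X i j (Xm⊆σ∩X i j ∈Xm)) ,
                  ∪-restrict X σ≡ρ∪τ τ⊆X))
    where
    X : Cell m n
    X = Xp ∪c Xm

  link-∪∈T : HasFlip T Xp Xm L → ∀ {τ ρ} → MaximalIn (TX (Xp ∪c Xm) Xp) τ → L ρ → T (τ ∪c ρ)
  link-∪∈T flip {τ} {ρ} τ-maximal ρ∈L =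
    proj₂ (proj₂ (proj₂ (HasFlip.common-link flip τ τ-maximal ρ) ρ∈L))

  ∉flip⇒X∖x⊆ : ∀ {A σ} → IsTriangulation A T → IsCircuit A Xp Xm → HasFlip T Xp Xm L →
               T σ → ¬ FlipResult T Xp Xm L σ → Connected σ →
               ∀ {a b} → (a , b) ∈c Xp → ¬ ((a , b) ∈c σ) → (Xp ∪c Xm) ∖ (a , b) ⊆c σ
  ∉flip⇒X∖x⊆ {σ = σ} triangulation circuit flip σ∈T σ∉T' G[σ]-connected {a} {b} ab∈Xp ab∉σ i j ∈X∖ab =
    decidable-stable ((i , j) ∈c? σ) λ ij∉σ →
      ∉flip⇒¬¬decomposed σ∈T σ∉T' λ (ρ , τ , ρ∈L , τ⊆X , σ≡ρ∪τ) →
        let S = X ∖ (a , b) ∪c ρ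
            S∈T = link-∪∈T flip (∖-maximal X Xp (∈-∪⁺ˡ Xp Xm) ab∈Xp) ρ∈L
            e-vertex , f-vertex = circuit⁺-vertices σ circuit Xm⊆σ (ij∈Xp ij∉σ)
        in ij∉σ (walk⇒edge S (affInd S S∈T) (⊆-∖∪ X σ≡ρ∪τ τ⊆X ab∉σ) (∈-∪⁺ˡ (X ∖ (a , b)) ρ i j ∈X∖ab)
                           (G[σ]-connected (inj₁ i) (inj₂ j) e-vertex f-vertex))
    where
    open IsTriangulation triangulation
    X : Cell m n
    X = Xp ∪c Xm
    Xm⊆σ : Xm ⊆c σ
    Xm⊆σ = ∉flip⇒X⁻⊆ σ∈T σ∉T'
    ij∈Xp : ¬ ((i , j) ∈c σ) → (i , j) ∈c Xp
    ij∈Xp ij∉σ with ∈-∪⁻ Xp Xm i j (∈-∖⁻ X (a , b) i j ∈X∖ab)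
    ... | inj₁ ∈Xp = ∈Xp
    ... | inj₂ ∈Xm = contradiction (Xm⊆σ i j ∈Xm) ij∉σ

proposition6p1 : (m n : ℕ) (A : Cell m n) (T : Cell m n → Set)
    → IsTriangulation A T
    → (Xp Xm : Cell m n) → IsCircuit A Xp Xm
    → (L : Cell m n → Set) → HasFlip T Xp Xm L
    → (σ : Cell m n) → T σ → ¬ FlipResult T Xp Xm L σ → Connected σ
    → Σ (Cell m n) (λ τ → MaximalIn (TX (Xp ∪c Xm) Xp) τ × (τ ⊆c σ))
proposition6p1 m n A T triangulation Xp Xm circuit L flip σ σ∈T σ∉T' G[σ]-connected =
  let a , b , ab∈Xp , ab∉σ = ⊈-witness Xp σ Xp⊈σ
  in (Xp ∪c Xm) ∖ (a , b) ,
     ∖-maximal (Xp ∪c Xm) Xp (∈-∪⁺ˡ Xp Xm) ab∈Xp ,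
     ∉flip⇒X∖x⊆ triangulation circuit flip σ∈T σ∉T' G[σ]-connected ab∈Xp ab∉σ
  where
  open Flip T Xp Xm L
  Xp⊈σ : ¬ (Xp ⊆c σ)
  Xp⊈σ Xp⊆σ = ¬circuit⊆independent σ circuit (IsTriangulation.affInd triangulation σ σ∈T)
                (∪-lub Xp Xm σ Xp⊆σ (∉flip⇒X⁻⊆ σ∈T σ∉T'))
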